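{- Let $n\ge2$ and consider the square $n\times n$ table. Then for all $2\le s\le n$, \[\mathcal{D}(s,1)=3\,\mathcal{D}(s-1,1)-\mathcal{M}_{s-2}.\]
   Context: In the $n\times n$ table (rows $1,\dots,n$), with steps $(1,0),(1,1),(1,-1)$, $\mathcal{D}(s,t)$ is the number of sequences $(r_1,\dots,r_s)$ with $r_i\in\{1,\dots,n\}$, $|r_{i+1}-r_i|\le1$ and $r_s=t$ (paths from any cell of the first column to the cell in column $s$, row $t$, staying in the table). $\mathcal{M}_k$ ($k\ge0$) is the $k$-th Motzkin number: the number of lattice paths from $(0,0)$ to $(k,0)$ with steps $(1,1),(1,-1),(1,0)$ never going below the $x$-axis ($\mathcal{M}_0=\mathcal{M}_1=1,\mathcal{M}_2=2,\mathcal{M}_3=4,\dots$). -}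

module Defs where

open import Data.Nat using (ℕ; zero; suc; _+_; _∸_; _≤_; _≤ᵇ_)
open import Data.Bool using (Bool; true; false; _∧_; if_then_else_)
open import Data.List using (List; []; _∷_; map; concatMap; length; filterᵇ; upTo; last)
open import Data.Maybe using (Maybe; just; nothing)
open import Relation.Nullary.Decidable using (⌊_⌋)
open import Data.Nat using (_≟_)
open import Data.Integer as ℤ using (ℤ; +_; 0ℤ)
open import Data.Product using (_×_; _,_)

words : {A : Set} → List A → ℕ → List (List A)
words xs zero = [] ∷ []
words xs (suc k) = concatMap (λ w → map (λ x → x ∷ w) xs) (words xs k)

rows : ℕ → List ℕ
rows n = map suc (upTo n)

adj : ℕ → ℕ → Bool
adj a b = ((a ∸ b) + (b ∸ a)) ≤ᵇ 1

validSeq : List ℕ → Bool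
validSeq [] = true
validSeq (a ∷ []) = true
validSeq (a ∷ b ∷ r) = adj a b ∧ validSeq (b ∷ r)

endsAt : ℕ → List ℕ → Bool
endsAt t r with last r
... | just x = ⌊ x ≟ t ⌋
... | nothing = false

-- D n s t : number of sequences (r_1,…,r_s), r_i ∈ {1,…,n},
-- |r_{i+1} - r_i| ≤ 1, r_s = t   (in the n × n table)
D : ℕ → ℕ → ℕ → ℕ
D n s t = length (filterᵇ (λ r → validSeq r ∧ endsAt t r) (words (rows n) s))

steps : List ℤ
steps = + 1 ∷ ℤ.- (+ 1) ∷ 0ℤ ∷ []

motzkinOK : ℤ → List ℤ → Bool
motzkinOK h [] = ⌊ h ℤ.≟ 0ℤ ⌋
motzkinOK h (x ∷ xs) = let h' = h ℤ.+ x in ⌊ 0ℤ ℤ.≤? h' ⌋ ∧ motzkinOK h' xs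

Motzkin : ℕ → ℕ
Motzkin k = length (filterᵇ (λ w → motzkinOK 0ℤ w) (words steps k))

module Submission where

-- A sequence in D(s, t) is a walk of s − 1 steps that ends in row t; counting them backwards from t,
-- D(s, t) is the (s − 1)-fold transfer operator of the table applied to the constant 1, at row t.
-- A walk of m steps from row 1 never sees row m + 2, so for s ≤ n the table can be replaced by the
-- half-line of rows 1, 2, …, whose transfer operator L is linear. There L1 = 3·1 − δ, δ the indicator
-- of the bottom row, so applying L^(s−2) gives L^(s−1)1 + L^(s−2)δ = 3·L^(s−2)1, and L^(s−2)δ at the
-- bottom row counts walks from the bottom row back to it: the Motzkin paths of length s − 2.

open import Defs
open import Data.Nat using (ℕ; _≤_; _*_; _∸_; _+_)
open import Relation.Binary.PropositionalEquality using (_≡_)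

open import Data.Bool using (Bool; true; false; _∧_; if_then_else_)
open import Data.Bool.Properties using (∧-assoc)
open import Data.Integer as ℤ using (ℤ; 0ℤ)
open import Data.List using (List; []; _∷_; map; concatMap; length; filterᵇ; upTo; _++_)
open import Data.List.Properties using (map-++; map-cong; map-∘; upTo-∷ʳ)
open import Data.Nat using (zero; suc; _<_; _≤ᵇ_; _≤′_; ≤′-reflexive; ≤′-step; s≤s; z≤n; _≟_)
open import Data.Nat.GeneralisedArithmetic using (fold; iterate; iterate-is-fold)
open import Data.Nat.ListAction using (sum)
open import Data.Nat.ListAction.Properties using (sum-++)
open import Data.Nat.Properties
open import Data.Nat.Solver using (module +-*-Solver)
open import Function using (_∘_; const)
open import Relation.Binary.PropositionalEquality
  using (_≢_; refl; sym; trans; subst; cong; cong₂; cong-app; module ≡-Reasoning)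
open import Relation.Nullary.Decidable using (⌊_⌋; isYes≗does; dec-true; dec-false)

open +-*-Solver
open ≡-Reasoning

∑ : {A : Set} → List A → (A → ℕ) → ℕ
∑ xs f = sum (map f xs)

keepIf : Bool → ℕ → ℕ
keepIf b x = if b then x else 0

private
  variable
    A B : Set

∑-cong : {f g : A → ℕ} → (∀ x → f x ≡ g x) → ∀ xs → ∑ xs f ≡ ∑ xs g
∑-cong f≗g xs = cong sum (map-cong f≗g xs)

∑-++ : ∀ xs ys (f : A → ℕ) → ∑ (xs ++ ys) f ≡ ∑ xs f + ∑ ys f
∑-++ xs ys f = trans (cong sum (map-++ f xs ys)) (sum-++ (map f xs) (map f ys))

∑-+ : ∀ xs (f g : A → ℕ) → ∑ xs (λ x → f x + g x) ≡ ∑ xs f + ∑ xs g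
∑-+ []       f g = refl
∑-+ (x ∷ xs) f g = begin
  f x + g x + ∑ xs (λ x → f x + g x) ≡⟨ cong ((f x + g x) +_) (∑-+ xs f g) ⟩
  f x + g x + (∑ xs f + ∑ xs g)      ≡⟨ +-exchange (f x) (g x) (∑ xs f) (∑ xs g) ⟩
  f x + ∑ xs f + (g x + ∑ xs g)      ∎
  where
  +-exchange : ∀ a b c d → a + b + (c + d) ≡ a + c + (b + d)
  +-exchange = solve 4 (λ a b c d → a :+ b :+ (c :+ d) := a :+ c :+ (b :+ d)) refl

∑-zero : ∀ (xs : List A) → ∑ xs (const 0) ≡ 0
∑-zero []       = refl
∑-zero (x ∷ xs) = ∑-zero xs

∑-keepIf : ∀ b xs (f : A → ℕ) → ∑ xs (λ x → keepIf b (f x)) ≡ keepIf b (∑ xs f)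
∑-keepIf true  xs f = refl
∑-keepIf false xs f = ∑-zero xs

∑-concatMap : ∀ (g : A → List B) xs (f : B → ℕ) →
              ∑ (concatMap g xs) f ≡ ∑ xs (λ x → ∑ (g x) f)
∑-concatMap g []       f = refl
∑-concatMap g (x ∷ xs) f = begin
  ∑ (g x ++ concatMap g xs) f          ≡⟨ ∑-++ (g x) (concatMap g xs) f ⟩
  ∑ (g x) f + ∑ (concatMap g xs) f     ≡⟨ cong (∑ (g x) f +_) (∑-concatMap g xs f) ⟩
  ∑ (g x) f + ∑ xs (λ x → ∑ (g x) f)   ∎

length-filterᵇ : ∀ (p : A → Bool) xs → length (filterᵇ p xs) ≡ ∑ xs (λ x → keepIf (p x) 1)
length-filterᵇ p []       = refl
length-filterᵇ p (x ∷ xs) with p x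
... | true  = cong suc (length-filterᵇ p xs)
... | false = length-filterᵇ p xs

∑-words-suc : ∀ (xs : List A) k (f : List A → ℕ) →
              ∑ (words xs (suc k)) f ≡ ∑ (words xs k) (λ w → ∑ xs (λ x → f (x ∷ w)))
∑-words-suc xs k f = trans (∑-concatMap _ (words xs k) f)
  (∑-cong (λ w → cong sum (sym (map-∘ xs))) (words xs k))

keepIf-∧ : ∀ a b z → keepIf (a ∧ b) z ≡ keepIf b (keepIf a z)
keepIf-∧ true  b     z = refl
keepIf-∧ false true  z = refl
keepIf-∧ false false z = refl

∑-rows-suc : ∀ n (f : ℕ → ℕ) → ∑ (rows (suc n)) f ≡ ∑ (rows n) f + f (suc n)
∑-rows-suc n f = begin
  ∑ (map suc (upTo (suc n))) f           ≡⟨ cong (λ l → ∑ (map suc l) f) (sym (upTo-∷ʳ n)) ⟩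
  ∑ (map suc (upTo n ++ n ∷ [])) f       ≡⟨ cong (λ l → ∑ l f) (map-++ suc (upTo n) (n ∷ [])) ⟩
  ∑ (rows n ++ suc n ∷ []) f             ≡⟨ ∑-++ (rows n) (suc n ∷ []) f ⟩
  ∑ (rows n) f + (f (suc n) + 0)         ≡⟨ cong (∑ (rows n) f +_) (+-identityʳ (f (suc n))) ⟩
  ∑ (rows n) f + f (suc n)               ∎

∑-rows-vanish : ∀ k (f : ℕ → ℕ) → (∀ x → x ≤ k → f x ≡ 0) → ∑ (rows k) f ≡ 0
∑-rows-vanish zero    f f≡0 = refl
∑-rows-vanish (suc k) f f≡0 = begin
  ∑ (rows (suc k)) f        ≡⟨ ∑-rows-suc k f ⟩
  ∑ (rows k) f + f (suc k)  ≡⟨ cong₂ _+_ (∑-rows-vanish k f (λ x x≤k → f≡0 x (m≤n⇒m≤1+n x≤k)))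
                                       (f≡0 (suc k) ≤-refl) ⟩
  0                         ∎

∑-rows-truncate : ∀ {k n} (f : ℕ → ℕ) → k ≤′ n → (∀ x → k < x → f x ≡ 0) →
                  ∑ (rows n) f ≡ ∑ (rows k) f
∑-rows-truncate f (≤′-reflexive refl) f≡0 = refl
∑-rows-truncate {k} f (≤′-step {n} k≤′n) f≡0 = begin
  ∑ (rows (suc n)) f        ≡⟨ ∑-rows-suc n f ⟩
  ∑ (rows n) f + f (suc n)  ≡⟨ cong₂ _+_ (∑-rows-truncate f k≤′n f≡0) (f≡0 (suc n) (s≤s (≤′⇒≤ k≤′n))) ⟩
  ∑ (rows k) f + 0          ≡⟨ +-identityʳ _ ⟩
  ∑ (rows k) f              ∎

∑-rows-select : ∀ {t n} (g : ℕ → ℕ) → 1 ≤ t → t ≤ n →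
                ∑ (rows n) (λ x → keepIf ⌊ x ≟ t ⌋ (g x)) ≡ g t
∑-rows-select {suc t} {n} g _ t≤n = begin
  ∑ (rows n) select
    ≡⟨ ∑-rows-truncate select (≤⇒≤′ t≤n) (λ x t<x → unselected x (>⇒≢ t<x)) ⟩
  ∑ (rows (suc t)) select
    ≡⟨ ∑-rows-suc t select ⟩
  ∑ (rows t) select + select (suc t)
    ≡⟨ cong₂ _+_ (∑-rows-vanish t select (λ x x≤t → unselected x (<⇒≢ (s≤s x≤t))))
                 (cong (λ b → keepIf b (g (suc t))) selected) ⟩
  g (suc t) ∎
  where
  select : ℕ → ℕ
  select x = keepIf ⌊ x ≟ suc t ⌋ (g x)
  unselected : ∀ x → x ≢ suc t → select x ≡ 0
  unselected x x≢t = cong (λ b → keepIf b (g x)) (trans (isYes≗does (x ≟ suc t)) (dec-false (x ≟ suc t) x≢t))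
  selected : ⌊ suc t ≟ suc t ⌋ ≡ true
  selected = trans (isYes≗does (suc t ≟ suc t)) (dec-true (suc t ≟ suc t) refl)

adj-comm : ∀ a b → adj a b ≡ adj b a
adj-comm a b = cong (_≤ᵇ 1) (+-comm (a ∸ b) (b ∸ a))

adj-refl : ∀ a → adj a a ≡ true
adj-refl zero    = refl
adj-refl (suc a) = adj-refl a

adj-suc : ∀ a → adj a (suc a) ≡ true
adj-suc zero    = refl
adj-suc (suc a) = adj-suc a

adj-far : ∀ {a b} → suc (suc a) ≤ b → adj a b ≡ false
adj-far {zero}  {suc zero}    (s≤s ())
adj-far {zero}  {suc (suc b)} _           = refl
adj-far {suc a} {suc b}       (s≤s 2+a≤b) = adj-far 2+a≤b

tableStep : ℕ → (ℕ → ℕ) → ℕ → ℕ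
tableStep n g h = ∑ (rows n) (λ x → keepIf (adj x h) (g x))

tableWalks : ℕ → ℕ → ℕ → ℕ
tableWalks n m = fold (const 1) (tableStep n) m

-- words extends sequences at the front, so the weight g falls on the first entry while the last stays t.
pathSum : ℕ → ℕ → ℕ → (ℕ → ℕ) → ℕ
pathSum n t k g =
  ∑ (words (rows n) k) (λ w → ∑ (rows n) (λ x → keepIf (validSeq (x ∷ w) ∧ endsAt t (x ∷ w)) (g x)))

module _ (n t : ℕ) where

  pathSum-suc : ∀ k g → pathSum n t (suc k) g ≡ pathSum n t k (tableStep n g)
  pathSum-suc k g = begin
    pathSum n t (suc k) g
      ≡⟨ ∑-words-suc (rows n) k _ ⟩
    ∑ (words (rows n) k) (λ w → ∑ (rows n) (λ y → ∑ (rows n) (λ x → weight x y w)))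
      ≡⟨ ∑-cong (λ w → ∑-cong (λ y → extend y w) (rows n)) (words (rows n) k) ⟩
    pathSum n t k (tableStep n g) ∎
    where
    weight : ℕ → ℕ → List ℕ → ℕ
    weight x y w = keepIf ((adj x y ∧ validSeq (y ∷ w)) ∧ endsAt t (y ∷ w)) (g x)
    extend : ∀ y w → ∑ (rows n) (λ x → weight x y w)
                   ≡ keepIf (validSeq (y ∷ w) ∧ endsAt t (y ∷ w)) (tableStep n g y)
    extend y w = begin
      ∑ (rows n) (λ x → weight x y w)
        ≡⟨ ∑-cong (λ x → trans (cong (λ b → keepIf b (g x)) (∧-assoc (adj x y) _ _))
                               (keepIf-∧ (adj x y) _ (g x))) (rows n) ⟩
      ∑ (rows n) (λ x → keepIf (validSeq (y ∷ w) ∧ endsAt t (y ∷ w)) (keepIf (adj x y) (g x)))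
        ≡⟨ ∑-keepIf _ (rows n) _ ⟩
      keepIf (validSeq (y ∷ w) ∧ endsAt t (y ∷ w)) (tableStep n g y) ∎

  pathSum-iterate : 1 ≤ t → t ≤ n → ∀ k g → pathSum n t k g ≡ iterate (tableStep n) g k t
  pathSum-iterate 1≤t t≤n zero    g = trans (+-identityʳ _) (∑-rows-select g 1≤t t≤n)
  pathSum-iterate 1≤t t≤n (suc k) g = trans (pathSum-suc k g) (pathSum-iterate 1≤t t≤n k (tableStep n g))

  D-suc≡tableWalks : 1 ≤ t → t ≤ n → ∀ k → D n (suc k) t ≡ tableWalks n k t
  D-suc≡tableWalks 1≤t t≤n k = begin
    D n (suc k) t                           ≡⟨ length-filterᵇ _ (words (rows n) (suc k)) ⟩
    ∑ (words (rows n) (suc k)) _            ≡⟨ ∑-words-suc (rows n) k _ ⟩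
    pathSum n t k (const 1)                 ≡⟨ pathSum-iterate 1≤t t≤n k (const 1) ⟩
    iterate (tableStep n) (const 1) k t     ≡⟨ cong-app (sym (iterate-is-fold (const 1) (tableStep n) k)) t ⟩
    tableWalks n k t                        ∎

-- Functions on the half-line of rows 1, 2, … store row i + 1 at index i; below is 0 at the floor.
below : (ℕ → ℕ) → ℕ → ℕ
below g zero    = 0
below g (suc i) = g i

lineStep : (ℕ → ℕ) → ℕ → ℕ
lineStep g i = below g i + g i + g (suc i)

lineWalks : ℕ → ℕ → ℕ
lineWalks m = fold (const 1) lineStep m

atFloor : ℕ → ℕ
atFloor zero    = 1
atFloor (suc _) = 0

motzkinFrom : ℕ → ℕ → ℕ
motzkinFrom m = fold atFloor lineStep m

AgreeUpTo : ℕ → (ℕ → ℕ) → (ℕ → ℕ) → Set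
AgreeUpTo h f g = ∀ i → i ≤ h → f i ≡ g i

lineStep-cong : ∀ {h f g} → AgreeUpTo (suc h) f g → AgreeUpTo h (lineStep f) (lineStep g)
lineStep-cong {h} {f} {g} f≡g i i≤h =
  cong₂ _+_ (cong₂ _+_ (below-cong i i≤h) (f≡g i (m≤n⇒m≤1+n i≤h))) (f≡g (suc i) (s≤s i≤h))
  where
  below-cong : ∀ i → i ≤ h → below f i ≡ below g i
  below-cong zero    _   = refl
  below-cong (suc j) j<h = f≡g j (m≤n⇒m≤1+n (<⇒≤ j<h))

lineStep-linear : ∀ c {f g h} → (∀ i → f i + g i ≡ c * h i) →
                  ∀ i → lineStep f i + lineStep g i ≡ c * lineStep h i
lineStep-linear c {f} {g} {h} eq i = begin
  lineStep f i + lineStep g i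
    ≡⟨ regroup (below f i) (f i) (f (suc i)) (below g i) (g i) (g (suc i)) ⟩
  (below f i + below g i) + (f i + g i) + (f (suc i) + g (suc i))
    ≡⟨ cong₂ _+_ (cong₂ _+_ (below-linear i) (eq i)) (eq (suc i)) ⟩
  c * below h i + c * h i + c * h (suc i)
    ≡⟨ distrib c (below h i) (h i) (h (suc i)) ⟩
  c * lineStep h i ∎
  where
  below-linear : ∀ i → below f i + below g i ≡ c * below h i
  below-linear zero    = sym (*-zeroʳ c)
  below-linear (suc i) = eq i
  regroup : ∀ a b d a′ b′ d′ → a + b + d + (a′ + b′ + d′) ≡ (a + a′) + (b + b′) + (d + d′)
  regroup = solve 6 (λ a b d a′ b′ d′ →
    a :+ b :+ d :+ (a′ :+ b′ :+ d′) := (a :+ a′) :+ (b :+ b′) :+ (d :+ d′)) refl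
  distrib : ∀ c x y z → c * x + c * y + c * z ≡ c * (x + y + z)
  distrib = solve 4 (λ c x y z → c :* x :+ c :* y :+ c :* z := c :* (x :+ y :+ z)) refl

lineWalks-suc : ∀ m i → lineWalks (suc m) i + motzkinFrom m i ≡ 3 * lineWalks m i
lineWalks-suc zero    zero    = refl
lineWalks-suc zero    (suc i) = refl
lineWalks-suc (suc m) i       = lineStep-linear 3 (lineWalks-suc m) i

module _ (g : ℕ → ℕ) where

  private
    towards : ℕ → ℕ → ℕ
    towards h x = keepIf (adj x h) (g x)

  ∑-rows-towards-suc : ∀ i → ∑ (rows i) (towards (suc i)) ≡ below (g ∘ suc) i
  ∑-rows-towards-suc zero    = refl
  ∑-rows-towards-suc (suc i) = begin
    ∑ (rows (suc i)) (towards (2 + i))                  ≡⟨ ∑-rows-suc i (towards (2 + i)) ⟩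
    ∑ (rows i) (towards (2 + i)) + towards (2 + i) (suc i)
      ≡⟨ cong₂ _+_ (∑-rows-vanish i _ (λ x x≤i → cong (λ b → keepIf b (g x)) (adj-far (s≤s (s≤s x≤i)))))
                   (cong (λ b → keepIf b (g (suc i))) (adj-suc (suc i))) ⟩
    g (suc i)                                           ∎

  tableStep-interior : ∀ {n} i → 2 + i ≤ n → tableStep n g (suc i) ≡ lineStep (g ∘ suc) i
  tableStep-interior {n} i 2+i≤n = begin
    ∑ (rows n) (towards (suc i))
      ≡⟨ ∑-rows-truncate _ (≤⇒≤′ 2+i≤n)
           (λ x 2+i<x → cong (λ b → keepIf b (g x)) (trans (adj-comm x (suc i)) (adj-far 2+i<x))) ⟩
    ∑ (rows (2 + i)) (towards (suc i))
      ≡⟨ ∑-rows-suc (suc i) (towards (suc i)) ⟩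
    ∑ (rows (suc i)) (towards (suc i)) + towards (suc i) (2 + i)
      ≡⟨ cong (_+ towards (suc i) (2 + i)) (∑-rows-suc i (towards (suc i))) ⟩
    ∑ (rows i) (towards (suc i)) + towards (suc i) (suc i) + towards (suc i) (2 + i)
      ≡⟨ cong₂ _+_ (cong₂ _+_ (∑-rows-towards-suc i) (cong (λ b → keepIf b (g (suc i))) (adj-refl (suc i))))
                   (cong (λ b → keepIf b (g (2 + i))) (trans (adj-comm (2 + i) (suc i)) (adj-suc (suc i)))) ⟩
    lineStep (g ∘ suc) i ∎

fold-tableStep-interior : ∀ {n} m h {g g′} → h + m < n → AgreeUpTo (h + m) (g ∘ suc) g′ →
                          AgreeUpTo h (fold g (tableStep n) m ∘ suc) (fold g′ lineStep m)
fold-tableStep-interior zero    h _ agree i i≤h = agree i (≤-trans i≤h (m≤m+n h 0))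
fold-tableStep-interior {n} (suc m) h {g} {g′} h+m<n agree i i≤h = begin
  tableStep n (fold g (tableStep n) m) (suc i)
    ≡⟨ tableStep-interior _ i (≤-trans (s≤s (s≤s (≤-trans i≤h (m≤m+n h m)))) 1+h+m<n) ⟩
  lineStep (fold g (tableStep n) m ∘ suc) i
    ≡⟨ lineStep-cong (fold-tableStep-interior m (suc h) 1+h+m<n agree′) i i≤h ⟩
  lineStep (fold g′ lineStep m) i ∎
  where
  1+h+m<n : suc h + m < n
  1+h+m<n = subst (_< n) (+-suc h m) h+m<n
  agree′ : AgreeUpTo (suc h + m) (g ∘ suc) g′
  agree′ j j≤ = agree j (≤-trans j≤ (≤-reflexive (sym (+-suc h m))))

tableWalks-bottom : ∀ {n m} → m < n → tableWalks n m 1 ≡ lineWalks m 0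
tableWalks-bottom {m = m} m<n = fold-tableStep-interior m 0 m<n (λ _ _ → refl) 0 z≤n

motzkinCount : ℕ → ℕ → ℕ
motzkinCount k h = ∑ (words steps k) (λ w → keepIf (motzkinOK (ℤ.+ h) w) 1)

motzkinCount-suc : ∀ k h → motzkinCount (suc k) h ≡ lineStep (motzkinCount k) h
motzkinCount-suc k h = begin
  motzkinCount (suc k) h
    ≡⟨ ∑-words-suc steps k _ ⟩
  ∑ ws (λ w → up w + (down w + (flat w + 0)))
    ≡⟨ ∑-+ ws up _ ⟩
  ∑ ws up + ∑ ws (λ w → down w + (flat w + 0))
    ≡⟨ cong (∑ ws up +_) (∑-+ ws down _) ⟩
  ∑ ws up + (∑ ws down + ∑ ws (λ w → flat w + 0))
    ≡⟨ cong₂ (λ a b → motzkinCount k a + (∑ ws down + b)) (+-comm h 1)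
             (trans (∑-cong (λ w → +-identityʳ (flat w)) ws) (cong (motzkinCount k) (+-identityʳ h))) ⟩
  motzkinCount k (suc h) + (∑ ws down + motzkinCount k h)
    ≡⟨ cong (λ a → motzkinCount k (suc h) + (a + motzkinCount k h)) (down-step h) ⟩
  motzkinCount k (suc h) + (below (motzkinCount k) h + motzkinCount k h)
    ≡⟨ +-comm (motzkinCount k (suc h)) _ ⟩
  lineStep (motzkinCount k) h ∎
  where
  ws : List (List ℤ)
  ws = words steps k
  up down flat : List ℤ → ℕ
  up   w = keepIf (motzkinOK (ℤ.+ h) (ℤ.+ 1 ∷ w)) 1
  down w = keepIf (motzkinOK (ℤ.+ h) (ℤ.- (ℤ.+ 1) ∷ w)) 1
  flat w = keepIf (motzkinOK (ℤ.+ h) (0ℤ ∷ w)) 1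
  down-step : ∀ h → ∑ ws (λ w → keepIf (motzkinOK (ℤ.+ h) (ℤ.- (ℤ.+ 1) ∷ w)) 1)
                    ≡ below (motzkinCount k) h
  down-step zero    = ∑-zero ws
  down-step (suc h) = refl

motzkinCount≡motzkinFrom : ∀ k h → motzkinCount k h ≡ motzkinFrom k h
motzkinCount≡motzkinFrom zero    zero    = refl
motzkinCount≡motzkinFrom zero    (suc h) = refl
motzkinCount≡motzkinFrom (suc k) h       = begin
  motzkinCount (suc k) h            ≡⟨ motzkinCount-suc k h ⟩
  lineStep (motzkinCount k) h       ≡⟨ lineStep-cong (λ i _ → motzkinCount≡motzkinFrom k i) h ≤-refl ⟩
  lineStep (motzkinFrom k) h        ∎

Motzkin≡motzkinFrom : ∀ k → Motzkin k ≡ motzkinFrom k 0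
Motzkin≡motzkinFrom k = trans (length-filterᵇ _ (words steps k)) (motzkinCount≡motzkinFrom k 0)

lemma2p6 : (n : ℕ) → 2 ≤ n → (s : ℕ) → 2 ≤ s → s ≤ n →
           D n s 1 + Motzkin (s ∸ 2) ≡ 3 * D n (s ∸ 1) 1
lemma2p6 n _ (suc zero)    (s≤s ()) _
lemma2p6 n _ (suc (suc m)) _        s≤n = begin
  D n (2 + m) 1 + Motzkin m                ≡⟨ cong₂ _+_ (D-suc≡tableWalks n 1 ≤-refl 1≤n (suc m))
                                                         (Motzkin≡motzkinFrom m) ⟩
  tableWalks n (suc m) 1 + motzkinFrom m 0 ≡⟨ cong (_+ motzkinFrom m 0) (tableWalks-bottom s≤n) ⟩
  lineWalks (suc m) 0 + motzkinFrom m 0    ≡⟨ lineWalks-suc m 0 ⟩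
  3 * lineWalks m 0                        ≡⟨ cong (3 *_) (tableWalks-bottom (<⇒≤ s≤n)) ⟨
  3 * tableWalks n m 1                     ≡⟨ cong (3 *_) (D-suc≡tableWalks n 1 ≤-refl 1≤n m) ⟨
  3 * D n (suc m) 1                        ∎
  where
  1≤n : 1 ≤ n
  1≤n = ≤-trans (s≤s z≤n) s≤n
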